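{- Let $G_1$ and $G_2$ be finite graphs on $n_1$ and $n_2$ vertices respectively, and let $k_1,k_2$ be natural numbers. If $n_1-k_1=n_2-k_2$ and $G_1'\cong G_2'$, then $\mathcal{B}_{\geq k_1}(G_1)\cong\mathcal{B}_{\geq k_2}(G_2)$.
   Context: Graphs are finite and simple. A vertex of $G$ is universal if it has degree $|V(G)|-1$; $G'$ is the graph obtained from $G$ by removing all universal vertices. An independent set partition of $G$ is a partition of $V(G)$ into nonempty independent sets (parts). For such a partition $P$ and $v\in V(G)$, let $P-v$ be the partition of $V(G)\setminus\{v\}$ obtained by deleting $v$ from its part (discarding that part if empty). The Bell colouring graph $\mathcal{B}(G)$ has as vertices the independent set partitions of $G$, with $P\neq Q$ adjacent iff $P-v=Q-v$ for some $v\in V(G)$; $\mathcal{B}_{\geq k}(G)$ is its induced subgraph on partitions with at least $k$ parts. -}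

module Defs where

open import Data.Nat using (ℕ; _+_; _≤_; _<ᵇ_)
open import Data.Fin using (Fin; toℕ)
open import Data.Bool using (Bool; true; false; not; _∧_; _∨_; if_then_else_)
open import Data.List using (List; allFin; map; foldr)
open import Data.Nat.ListAction using (sum)
open import Data.Product using (Σ; ∃; _×_; _,_; proj₁)
open import Relation.Nullary using (¬_)
open import Relation.Binary.PropositionalEquality using (_≡_; _≢_)

record Graph (n : ℕ) : Set where
  field
    adj   : Fin n → Fin n → Bool
    sym   : ∀ u v → adj u v ≡ adj v u
    irrefl : ∀ v → adj v v ≡ false
open Graph public

-- Abstract graphs whose vertex type carries an equality relation _≈_
-- (needed since partitions are represented as relations, compared pointwise).

record SGraph : Set₁ where
  field
    V   : Set
    _≈_ : V → V → Set
    E   : V → V → Set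

record _≅_ (A B : SGraph) : Set where
  private
    module A = SGraph A
    module B = SGraph B
  field
    to        : A.V → B.V
    from      : B.V → A.V
    to-cong   : ∀ {x y} → x A.≈ y → to x B.≈ to y
    from-cong : ∀ {x y} → x B.≈ y → from x A.≈ from y
    from∘to   : ∀ x → from (to x) A.≈ x
    to∘from   : ∀ y → to (from y) B.≈ y
    E-pres    : ∀ x y → A.E x y → B.E (to x) (to y)
    E-refl    : ∀ x y → B.E (to x) (to y) → A.E x y

Universal : ∀ {n} → Graph n → Fin n → Set
Universal G v = ∀ u → u ≢ v → adj G u v ≡ true

reduced : ∀ {n} → Graph n → SGraph
reduced {n} G = record
  { V   = Σ (Fin n) (λ v → ¬ Universal G v)
  ; _≈_ = λ x y → proj₁ x ≡ proj₁ y
  ; E   = λ x y → adj G (proj₁ x) (proj₁ y) ≡ true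
  }

record ISPartition {n : ℕ} (G : Graph n) : Set where
  field
    same       : Fin n → Fin n → Bool
    same-refl  : ∀ x → same x x ≡ true
    same-sym   : ∀ x y → same x y ≡ same y x
    same-trans : ∀ x y z → same x y ≡ true → same y z ≡ true → same x z ≡ true
    indep      : ∀ x y → same x y ≡ true → adj G x y ≡ false
open ISPartition public

_≈P_ : ∀ {n} {G : Graph n} → ISPartition G → ISPartition G → Set
P ≈P Q = ∀ x y → same P x y ≡ same Q x y

agreeOff : ∀ {n} {G : Graph n} → Fin n → ISPartition G → ISPartition G → Set
agreeOff v P Q = ∀ x y → x ≢ v → y ≢ v → same P x y ≡ same Q x y

-- number of parts = number of vertices that are least (in Fin order) in their part
isLeader : ∀ {n} {G : Graph n} → ISPartition G → Fin n → Bool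
isLeader {n} P v = foldr (λ u b → not ((toℕ u <ᵇ toℕ v) ∧ same P u v) ∧ b) true (allFin n)

numParts : ∀ {n} {G : Graph n} → ISPartition G → ℕ
numParts {n} P = sum (map (λ v → if isLeader P v then 1 else 0) (allFin n))

Bell≥ : ∀ {n} → ℕ → Graph n → SGraph
Bell≥ {n} k G = record
  { V   = Σ (ISPartition G) (λ P → k ≤ numParts P)
  ; _≈_ = λ P Q → proj₁ P ≈P proj₁ Q
  ; E   = λ P Q → ¬ (proj₁ P ≈P proj₁ Q) × ∃ (λ v → agreeOff v (proj₁ P) (proj₁ Q))
  }

{-# OPTIONS --safe #-}
-- A universal vertex is adjacent to everything, so it is a singleton part of every
-- independent set partition.  Hence an independent set partition of G is the same
-- thing as one of G' together with one singleton per universal vertex, and it has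
-- (number of universal vertices) + (number of parts on G') parts.  An isomorphism
-- G₁' ≅ G₂' therefore transports partitions of G₁ to partitions of G₂, shifting the
-- number of parts by n₂ - n₁ = k₂ - k₁.  Two partitions differing only at a
-- universal vertex are equal, so Bell adjacency is witnessed at a vertex of G',
-- which the isomorphism moves along.
module Submission where

open import Defs
open import Data.Nat using (ℕ; _+_)
open import Relation.Binary.PropositionalEquality using (_≡_)

open import Data.Bool using (Bool; true; false; not; _∧_; if_then_else_)
open import Data.Bool.Properties
  using (∧-identityʳ; ∧-zeroʳ; not-injective; ¬-not) renaming (_≟_ to _≟ᵇ_)
open import Data.Fin using (Fin; zero; suc; toℕ; _<_)
open import Data.Fin.Induction using (Acc; acc; <-wellFounded)
open import Data.Fin.Properties using (_≟_; all?; <-cmp; suc-injective)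
open import Data.List using ([]; _∷_; foldr; tabulate; allFin)
open import Data.List.Membership.Propositional using (_∈_)
open import Data.List.Membership.Propositional.Properties using (∈-allFin)
open import Data.List.Properties using (map-tabulate; foldr-cong)
open import Data.List.Relation.Unary.Any using (here; there)
open import Data.Nat using (zero; suc; _≤_; z≤n; s≤s; _<ᵇ_) renaming (_<_ to _ℕ<_)
open import Data.Nat.ListAction using (sum)
open import Data.Nat.Properties
  using (+-comm; +-suc; +-cancelˡ-≤; +-monoʳ-≤; ≤-antisym; <-irrefl; <ᵇ-reflects-<; module ≤-Reasoning;
         +-commutativeSemigroup)
open import Algebra.Properties.CommutativeSemigroup +-commutativeSemigroup using (interchange)
open import Data.Nat.Tactic.RingSolver using (solve-∀)
open import Data.Product using (∃; _×_; _,_; proj₁; proj₂)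
open import Function using (_∘_; id; mk⇔)
open import Relation.Binary.Definitions using (tri<; tri≈; tri>)
open import Relation.Binary.PropositionalEquality
  using (refl; trans; cong; cong₂; subst; subst₂; _≢_; module ≡-Reasoning) renaming (sym to ≡-sym)
open import Relation.Nullary using (¬_; Dec; yes; no; does; ¬?; _→-dec_; contradiction)
open import Relation.Nullary.Decidable using (dec-true; dec-false; dec-no; does-⇔)
open import Relation.Nullary.Reflects using (ofʸ; ofⁿ)

∧-true⁻ : ∀ {a b} → a ∧ b ≡ true → a ≡ true × b ≡ true
∧-true⁻ {true} {true} refl = refl , refl

does-≟-sym : ∀ {n} (x y : Fin n) → does (x ≟ y) ≡ does (y ≟ x)
does-≟-sym x y = does-⇔ (mk⇔ ≡-sym ≡-sym) (x ≟ y) (y ≟ x)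

module _ {a} {A : Set a} (f : A → Bool) where

  foldr-∧-true⁻ : ∀ xs → foldr (λ x b → f x ∧ b) true xs ≡ true →
    ∀ {x} → x ∈ xs → f x ≡ true
  foldr-∧-true⁻ (y ∷ ys) h x∈ with f y in fy
  foldr-∧-true⁻ (y ∷ ys) h (here refl) | true = fy
  foldr-∧-true⁻ (y ∷ ys) h (there x∈)  | true = foldr-∧-true⁻ ys h x∈

  foldr-∧-true⁺ : ∀ xs → (∀ {x} → x ∈ xs → f x ≡ true) →
    foldr (λ x b → f x ∧ b) true xs ≡ true
  foldr-∧-true⁺ []       h = refl
  foldr-∧-true⁺ (y ∷ ys) h rewrite h (here refl) = foldr-∧-true⁺ ys (h ∘ there)

  foldr-∧-false⁻ : ∀ xs → foldr (λ x b → f x ∧ b) true xs ≡ false → ∃ λ x → f x ≡ false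
  foldr-∧-false⁻ (y ∷ ys) h with f y in fy
  ... | false = y , fy
  ... | true  = foldr-∧-false⁻ ys h

indicator : Bool → ℕ
indicator b = if b then 1 else 0

count : ∀ {n} → (Fin n → Bool) → ℕ
count {zero}  p = 0
count {suc n} p = indicator (p zero) + count (p ∘ suc)

numParts≡count : ∀ {n} {G : Graph n} (P : ISPartition G) → numParts P ≡ count (isLeader P)
numParts≡count P = trans (cong sum (map-tabulate id (indicator ∘ isLeader P))) (sum-tabulate (isLeader P))
  where
  sum-tabulate : ∀ {n} (p : Fin n → Bool) → sum (tabulate (indicator ∘ p)) ≡ count p
  sum-tabulate {zero}  p = refl
  sum-tabulate {suc n} p = cong (indicator (p zero) +_) (sum-tabulate (p ∘ suc))

count-cong : ∀ {n} {p q : Fin n → Bool} → (∀ x → p x ≡ q x) → count p ≡ count q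
count-cong {zero}  p≗q = refl
count-cong {suc n} p≗q = cong₂ _+_ (cong indicator (p≗q zero)) (count-cong (p≗q ∘ suc))

count-true : ∀ n → count {n} (λ _ → true) ≡ n
count-true zero    = refl
count-true (suc n) = cong suc (count-true n)

count-split : ∀ {n} (p r : Fin n → Bool) →
  count p ≡ count (λ x → p x ∧ r x) + count (λ x → p x ∧ not (r x))
count-split {zero}  p r = refl
count-split {suc n} p r =
  trans (cong₂ _+_ (indicator-split (p zero) (r zero)) (count-split (p ∘ suc) (r ∘ suc)))
        (interchange (indicator (p zero ∧ r zero)) (indicator (p zero ∧ not (r zero))) _ _)
  where
  indicator-split : ∀ a b → indicator a ≡ indicator (a ∧ b) + indicator (a ∧ not b)
  indicator-split false b     = refl
  indicator-split true  false = refl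
  indicator-split true  true  = refl

count-remove : ∀ {n} (q : Fin n → Bool) {a} → q a ≡ true →
  count q ≡ suc (count (λ y → q y ∧ not (does (y ≟ a))))
count-remove {suc n} q {zero} qa rewrite qa =
  cong suc (count-cong (λ y → ≡-sym (∧-identityʳ (q (suc y)))))
count-remove {suc n} q {suc a} qa rewrite ∧-identityʳ (q zero) =
  trans (cong (indicator (q zero) +_) (count-remove (q ∘ suc) qa)) (+-suc _ _)

count-mono-injection : ∀ {m n} (p : Fin m → Bool) (q : Fin n → Bool)
  (f : ∀ x → p x ≡ true → Fin n) →
  (∀ x px → q (f x px) ≡ true) →
  (∀ x y px py → f x px ≡ f y py → x ≡ y) →
  count p ≤ count q
count-mono-injection {zero} p q f f-q f-inj = z≤n
count-mono-injection {suc m} p q f f-q f-inj with p zero in p0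
... | false = count-mono-injection (p ∘ suc) q (f ∘ suc) (f-q ∘ suc)
                (λ x y px py → suc-injective ∘ f-inj (suc x) (suc y) px py)
... | true  = begin
  suc (count (p ∘ suc)) ≤⟨ s≤s (count-mono-injection (p ∘ suc) q′ (f ∘ suc) f-q′
                                 (λ x y px py → suc-injective ∘ f-inj (suc x) (suc y) px py)) ⟩
  suc (count q′)        ≡⟨ ≡-sym (count-remove q (f-q zero p0)) ⟩
  count q               ∎
  where
  open ≤-Reasoning
  q′ : Fin _ → Bool
  q′ y = q y ∧ not (does (y ≟ f zero p0))
  f-q′ : ∀ x px → q′ (f (suc x) px) ≡ true
  f-q′ x px rewrite f-q (suc x) px
    | dec-false (f (suc x) px ≟ f zero p0) (λ e → contradiction (f-inj (suc x) zero px p0 e) λ ())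
    = refl

module _ {n} {G : Graph n} (P : ISPartition G) where

  isLeader-true⁻ : ∀ {v} → isLeader P v ≡ true → ∀ u → toℕ u ℕ< toℕ v → same P u v ≡ false
  isLeader-true⁻ {v} isL u u<v
    with toℕ u <ᵇ toℕ v | <ᵇ-reflects-< (toℕ u) (toℕ v)
       | foldr-∧-true⁻ _ (allFin n) isL (∈-allFin u)
  ... | true  | _      | h = not-injective h
  ... | false | ofⁿ u≮v | _ = contradiction u<v u≮v

  isLeader-true⁺ : ∀ {v} → (∀ u → toℕ u ℕ< toℕ v → same P u v ≡ false) → isLeader P v ≡ true
  isLeader-true⁺ {v} earlier-apart = foldr-∧-true⁺ _ (allFin n) (λ {u} _ → not-earlier-same u)
    where
    not-earlier-same : ∀ u → not ((toℕ u <ᵇ toℕ v) ∧ same P u v) ≡ true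
    not-earlier-same u with toℕ u <ᵇ toℕ v | <ᵇ-reflects-< (toℕ u) (toℕ v)
    ... | true  | ofʸ u<v = cong not (earlier-apart u u<v)
    ... | false | _       = refl

  isLeader-false⁻ : ∀ {v} → isLeader P v ≡ false → ∃ λ u → toℕ u ℕ< toℕ v × same P u v ≡ true
  isLeader-false⁻ {v} notL with foldr-∧-false⁻ _ (allFin n) notL
  ... | u , h with toℕ u <ᵇ toℕ v | <ᵇ-reflects-< (toℕ u) (toℕ v) | same P u v in u~v
  ...   | true | ofʸ u<v | true = u , u<v , u~v

  isLeader-cong : ∀ {Q : ISPartition G} → P ≈P Q → ∀ v → isLeader P v ≡ isLeader Q v
  isLeader-cong P≈Q v =
    foldr-cong (λ u b → cong (λ s → not ((toℕ u <ᵇ toℕ v) ∧ s) ∧ b) (P≈Q u v)) refl (allFin n)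

  isLeader-unique : ∀ {a b} → isLeader P a ≡ true → isLeader P b ≡ true → same P a b ≡ true → a ≡ b
  isLeader-unique {a} {b} isLa isLb a~b with <-cmp a b
  ... | tri≈ _ a≡b _ = a≡b
  ... | tri< a<b _ _ = contradiction (trans (≡-sym a~b) (isLeader-true⁻ isLb a a<b)) λ ()
  ... | tri> _ _ b<a =
    contradiction (trans (≡-sym (trans (same-sym P b a) a~b)) (isLeader-true⁻ isLa b b<a)) λ ()

  leader : ∀ v → ∃ λ z → isLeader P z ≡ true × same P z v ≡ true
  leader v = leader-acc v (<-wellFounded v)
    where
    leader-acc : ∀ v → Acc _<_ v → ∃ λ z → isLeader P z ≡ true × same P z v ≡ true
    leader-acc v (acc earlier) with isLeader P v in isL
    ... | true  = v , isL , same-refl P v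
    ... | false with isLeader-false⁻ isL
    ...   | u , u<v , u~v with leader-acc u (earlier u<v)
    ...     | z , isLz , z~u = z , isLz , same-trans P z u v z~u u~v

universal? : ∀ {n} (G : Graph n) v → Dec (Universal G v)
universal? G v = all? (λ u → ¬? (u ≟ v) →-dec (adj G u v ≟ᵇ true))

isUniversal : ∀ {n} → Graph n → Fin n → Bool
isUniversal G v = does (universal? G v)

module _ {n} (G : Graph n) where

  not-isUniversal⁺ : ∀ {v} → ¬ Universal G v → not (isUniversal G v) ≡ true
  not-isUniversal⁺ {v} ¬U = cong not (dec-false (universal? G v) ¬U)

  not-isUniversal⁻ : ∀ {v} → not (isUniversal G v) ≡ true → ¬ Universal G v
  not-isUniversal⁻ {v} h U = contradiction (trans (≡-sym h) (cong not (dec-true (universal? G v) U))) λ ()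

module _ {n} {G : Graph n} where

  module _ (P : ISPartition G) where

    same-universalʳ : ∀ {v} → Universal G v → ∀ u → same P u v ≡ does (u ≟ v)
    same-universalʳ {v} U u with u ≟ v
    ... | yes refl = same-refl P v
    ... | no u≢v   = ¬-not λ u~v → contradiction (trans (≡-sym (U u u≢v)) (indep P u v u~v)) λ ()

    same-universalˡ : ∀ {v} → Universal G v → ∀ u → same P v u ≡ does (v ≟ u)
    same-universalˡ {v} U u = trans (same-sym P v u) (trans (same-universalʳ U u) (does-≟-sym u v))

    same-universal-nonuniversal : ∀ {u v} → Universal G u → ¬ Universal G v → same P u v ≡ false
    same-universal-nonuniversal {u} {v} U ¬V =
      trans (same-universalˡ U v) (dec-false (u ≟ v) λ { refl → ¬V U })

    same-nonuniversal-universal : ∀ {u v} → ¬ Universal G u → Universal G v → same P u v ≡ false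
    same-nonuniversal-universal {u} {v} ¬U V = trans (same-sym P u v) (same-universal-nonuniversal V ¬U)

    universal-isLeader : ∀ {v} → Universal G v → isLeader P v ≡ true
    universal-isLeader {v} U = isLeader-true⁺ P λ u u<v →
      trans (same-universalʳ U u) (dec-false (u ≟ v) λ u≡v → <-irrefl (cong toℕ u≡v) u<v)

  universal-agreeOff : ∀ {P Q : ISPartition G} {v} → Universal G v → agreeOff v P Q → P ≈P Q
  universal-agreeOff {P} {Q} {v} U agree x y with x ≟ v | y ≟ v
  ... | _        | yes refl = trans (same-universalʳ P U x) (≡-sym (same-universalʳ Q U x))
  ... | yes refl | no _     = trans (same-universalˡ P U y) (≡-sym (same-universalˡ Q U y))
  ... | no x≢v   | no y≢v   = agree x y x≢v y≢v

-- Pulling partitions back along homomorphisms of the reduced graphs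

V′ : ∀ {n} → Graph n → Set
V′ G = SGraph.V (reduced G)

record Hom′ {m n} (G : Graph m) (H : Graph n) : Set where
  field
    on-V : V′ G → V′ H
    on-E : ∀ x y → SGraph.E (reduced G) x y → SGraph.E (reduced H) (on-V x) (on-V y)
open Hom′

-- Only the vertex map enters sameVia, so the same-relation of a pullback does not depend on on-E.
module _ {m n} {G : Graph m} (H : Graph n) (f : V′ H → V′ G) (P : ISPartition G) where

  sameVia : ∀ {x y} → Dec (Universal H x) → Dec (Universal H y) → Bool
  sameVia {x} {y} (yes _)  (yes _)  = does (x ≟ y)
  sameVia         (no ¬ux) (no ¬uy) = same P (proj₁ (f (_ , ¬ux))) (proj₁ (f (_ , ¬uy)))
  sameVia         (yes _)  (no _)   = false
  sameVia         (no _)   (yes _)  = false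

  sameVia-refl : ∀ {x} (ux : Dec (Universal H x)) → sameVia ux ux ≡ true
  sameVia-refl {x} (yes _) = dec-true (x ≟ x) refl
  sameVia-refl     (no _)  = same-refl P _

  sameVia-sym : ∀ {x y} (ux : Dec (Universal H x)) (uy : Dec (Universal H y)) → sameVia ux uy ≡ sameVia uy ux
  sameVia-sym {x} {y} (yes _) (yes _) = does-≟-sym x y
  sameVia-sym         (no _)  (no _)  = same-sym P _ _
  sameVia-sym         (yes _) (no _)  = refl
  sameVia-sym         (no _)  (yes _) = refl

  sameVia-trans : ∀ {x y z} (ux : Dec (Universal H x)) (uy : Dec (Universal H y)) (uz : Dec (Universal H z)) →
    sameVia ux uy ≡ true → sameVia uy uz ≡ true → sameVia ux uz ≡ true
  sameVia-trans {x} {y} (yes _) (yes _) (yes _) x~y y~z with x ≟ y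
  ... | yes refl = y~z
  sameVia-trans (no _) (no _) (no _) x~y y~z = same-trans P _ _ _ x~y y~z

  sameVia-indep : (∀ x y → SGraph.E (reduced H) x y → SGraph.E (reduced G) (f x) (f y)) →
    ∀ {x y} (ux : Dec (Universal H x)) (uy : Dec (Universal H y)) →
    sameVia ux uy ≡ true → adj H x y ≡ false
  sameVia-indep f-E {x} {y} (yes _) (yes _) x~y with x ≟ y
  ... | yes refl = irrefl H x
  sameVia-indep f-E {x} {y} (no ¬ux) (no ¬uy) x~y = ¬-not λ xy →
    contradiction (trans (≡-sym (f-E (x , ¬ux) (y , ¬uy) xy)) (indep P _ _ x~y)) λ ()

module _ {m n} {G : Graph m} {H : Graph n} (f : Hom′ H G) where

  pullback : ISPartition G → ISPartition H
  pullback P = record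
    { same       = λ x y → sameVia H (on-V f) P (universal? H x) (universal? H y)
    ; same-refl  = λ x → sameVia-refl H (on-V f) P (universal? H x)
    ; same-sym   = λ x y → sameVia-sym H (on-V f) P (universal? H x) (universal? H y)
    ; same-trans = λ x y z → sameVia-trans H (on-V f) P (universal? H x) (universal? H y) (universal? H z)
    ; indep      = λ x y → sameVia-indep H (on-V f) P (on-E f) (universal? H x) (universal? H y)
    }

  same-pullback : ∀ P {x y} (¬ux : ¬ Universal H x) (¬uy : ¬ Universal H y) →
    same (pullback P) x y ≡ same P (proj₁ (on-V f (x , ¬ux))) (proj₁ (on-V f (y , ¬uy)))
  same-pullback P {x} {y} ¬ux ¬uy =
    cong₂ (sameVia H (on-V f) P {x} {y}) (dec-no (universal? H x) ¬ux) (dec-no (universal? H y) ¬uy)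

  pullback-cong : ∀ {P Q} → P ≈P Q → pullback P ≈P pullback Q
  pullback-cong {P} {Q} P≈Q x y = sameVia-cong (universal? H x) (universal? H y)
    where
    sameVia-cong : ∀ {x y} (ux : Dec (Universal H x)) (uy : Dec (Universal H y)) →
      sameVia H (on-V f) P ux uy ≡ sameVia H (on-V f) Q ux uy
    sameVia-cong (yes _) (yes _) = refl
    sameVia-cong (no _)  (no _)  = P≈Q _ _
    sameVia-cong (yes _) (no _)  = refl
    sameVia-cong (no _)  (yes _) = refl

module _ {m n} {G : Graph m} {H : Graph n} (f : Hom′ H G) (g : Hom′ G H)
  (f∘g : ∀ x → proj₁ (on-V f (on-V g x)) ≡ proj₁ x) where

  same-pullback-image : ∀ P x y →
    same (pullback f P) (proj₁ (on-V g x)) (proj₁ (on-V g y)) ≡ same P (proj₁ x) (proj₁ y)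
  same-pullback-image P x y =
    trans (same-pullback f P (proj₂ (on-V g x)) (proj₂ (on-V g y))) (cong₂ (same P) (f∘g x) (f∘g y))

  pullback-inverse : ∀ P → pullback g (pullback f P) ≈P P
  pullback-inverse P x y = sameVia-inverse (universal? G x) (universal? G y)
    where
    sameVia-inverse : (ux : Dec (Universal G x)) (uy : Dec (Universal G y)) →
      sameVia G (on-V g) (pullback f P) ux uy ≡ same P x y
    sameVia-inverse (yes _)  (yes uy) = ≡-sym (same-universalʳ P uy x)
    sameVia-inverse (no ¬ux) (no ¬uy) = same-pullback-image P (x , ¬ux) (y , ¬uy)
    sameVia-inverse (yes ux) (no ¬uy) = ≡-sym (same-universal-nonuniversal P ux ¬uy)
    sameVia-inverse (no ¬ux) (yes uy) = ≡-sym (same-nonuniversal-universal P ¬ux uy)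

module _ {n} {G : Graph n} where

  same-nonuniversal : ∀ (P : ISPartition G) {u v} → same P u v ≡ true → ¬ Universal G v → ¬ Universal G u
  same-nonuniversal P u~v ¬V U = contradiction (trans (≡-sym u~v) (same-universal-nonuniversal P U ¬V)) λ ()

  nonUniversalLeaders : ISPartition G → ℕ
  nonUniversalLeaders P = count (λ v → isLeader P v ∧ not (isUniversal G v))

  nonUniversalLeaders-cong : ∀ {P Q} → P ≈P Q → nonUniversalLeaders P ≡ nonUniversalLeaders Q
  nonUniversalLeaders-cong {P} {Q} P≈Q =
    count-cong λ v → cong (_∧ not (isUniversal G v)) (isLeader-cong P {Q} P≈Q v)

  numParts-split : ∀ P → numParts P ≡ count (isUniversal G) + nonUniversalLeaders P
  numParts-split P = begin
    numParts P
      ≡⟨ numParts≡count P ⟩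
    count (isLeader P)
      ≡⟨ count-split (isLeader P) (isUniversal G) ⟩
    count (λ v → isLeader P v ∧ isUniversal G v) + nonUniversalLeaders P
      ≡⟨ cong (_+ nonUniversalLeaders P) (count-cong (λ v → universal-leaders (universal? G v))) ⟩
    count (isUniversal G) + nonUniversalLeaders P ∎
    where
    open ≡-Reasoning
    universal-leaders : ∀ {v} (u? : Dec (Universal G v)) → isLeader P v ∧ does u? ≡ does u?
    universal-leaders (yes U) = cong (_∧ true) (universal-isLeader P U)
    universal-leaders (no _)  = ∧-zeroʳ _

  vertexCount-split : n ≡ count (isUniversal G) + count (not ∘ isUniversal G)
  vertexCount-split = trans (≡-sym (count-true n)) (count-split (λ _ → true) (isUniversal G))

nonUniversalLeaders-mono : ∀ {m n} {G : Graph m} {H : Graph n} {P : ISPartition G} {Q : ISPartition H}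
  (g : V′ G → V′ H) →
  (∀ x y → same Q (proj₁ (g x)) (proj₁ (g y)) ≡ same P (proj₁ x) (proj₁ y)) →
  nonUniversalLeaders P ≤ nonUniversalLeaders Q
nonUniversalLeaders-mono {G = G} {H} {P} {Q} g g-same =
  count-mono-injection _ _ leaderOfImage leaderOfImage-nonUniversal leaderOfImage-injective
  where
  NonUniversalLeader : Fin _ → Set
  NonUniversalLeader x = (isLeader P x ∧ not (isUniversal G x)) ≡ true

  asVertex : ∀ {x} → NonUniversalLeader x → V′ G
  asVertex {x} px = x , not-isUniversal⁻ G (proj₂ (∧-true⁻ px))

  leaderOfImage : ∀ x → NonUniversalLeader x → Fin _
  leaderOfImage x px = proj₁ (leader Q (proj₁ (g (asVertex px))))

  leaderOfImage-nonUniversal : ∀ x px →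
    (isLeader Q (leaderOfImage x px) ∧ not (isUniversal H (leaderOfImage x px))) ≡ true
  leaderOfImage-nonUniversal x px =
    let (_ , isLz , z~gx) = leader Q (proj₁ (g (asVertex px)))
    in  cong₂ _∧_ isLz (not-isUniversal⁺ H (same-nonuniversal Q z~gx (proj₂ (g (asVertex px)))))

  leaderOfImage-injective : ∀ x y px py → leaderOfImage x px ≡ leaderOfImage y py → x ≡ y
  leaderOfImage-injective x y px py z≡z′ =
    let (z  , _ , z~gx)  = leader Q (proj₁ (g (asVertex px)))
        (z′ , _ , z′~gy) = leader Q (proj₁ (g (asVertex py)))
        gx~gy = same-trans Q _ z _ (trans (same-sym Q _ z) z~gx)
                  (subst (λ w → same Q w _ ≡ true) (≡-sym z≡z′) z′~gy)
    in  isLeader-unique P (proj₁ (∧-true⁻ px)) (proj₁ (∧-true⁻ py))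
          (trans (≡-sym (g-same (asVertex px) (asVertex py))) gx~gy)

-- Transport along an isomorphism of the reduced graphs

-- A wrapper, so that G and H can be inferred from an isomorphism (reduced is not injective).
record _≅′_ {m n} (G : Graph m) (H : Graph n) : Set where
  constructor reduced-iso
  field iso : reduced G ≅ reduced H

module _ {m n} {G : Graph m} {H : Graph n} (I : G ≅′ H) where
  open _≅_ (_≅′_.iso I)

  toHom : Hom′ G H
  toHom = record { on-V = to ; on-E = E-pres }

  fromHom : Hom′ H G
  fromHom = record
    { on-V = from
    ; on-E = λ x y xy → E-refl (from x) (from y) (adj-resp (≡-sym (to∘from x)) (≡-sym (to∘from y)) xy)
    }
    where adj-resp = subst₂ (λ a b → adj H a b ≡ true)

  ≅′-sym : H ≅′ G
  ≅′-sym = reduced-iso record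
    { to        = from
    ; from      = to
    ; to-cong   = from-cong
    ; from-cong = to-cong
    ; from∘to   = to∘from
    ; to∘from   = from∘to
    ; E-pres    = on-E fromHom
    ; E-refl    = λ x y e → adj-resp (to∘from x) (to∘from y) (E-pres (from x) (from y) e)
    }
    where adj-resp = subst₂ (λ a b → adj H a b ≡ true)

  transport : ISPartition G → ISPartition H
  transport = pullback fromHom

  transport-cong : ∀ {P Q} → P ≈P Q → transport P ≈P transport Q
  transport-cong = pullback-cong fromHom

  same-transport-to : ∀ P x y →
    same (transport P) (proj₁ (to x)) (proj₁ (to y)) ≡ same P (proj₁ x) (proj₁ y)
  same-transport-to = same-pullback-image fromHom toHom from∘to

  transport-agreeOff : ∀ {P Q v} → ¬ P ≈P Q → agreeOff v P Q →
    ∃ λ w → agreeOff w (transport P) (transport Q)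
  transport-agreeOff {P} {Q} {v} P≉Q agree with universal? G v
  ... | yes U  = contradiction (universal-agreeOff {P = P} {Q} U agree) P≉Q
  ... | no ¬U = w , λ x y x≢w y≢w → sameVia-agree (universal? H x) (universal? H y) x≢w y≢w
    where
    w = proj₁ (to (v , ¬U))
    from-avoids-v : ∀ {x} (¬ux : ¬ Universal H x) → x ≢ w → proj₁ (from (x , ¬ux)) ≢ v
    from-avoids-v {x} ¬ux x≢w fx≡v = x≢w (trans (≡-sym (to∘from (x , ¬ux))) (to-cong fx≡v))
    sameVia-agree : ∀ {x y} (ux : Dec (Universal H x)) (uy : Dec (Universal H y)) → x ≢ w → y ≢ w →
      sameVia H from P ux uy ≡ sameVia H from Q ux uy
    sameVia-agree (yes _)  (yes _)  _   _   = refl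
    sameVia-agree (no ¬ux) (no ¬uy) x≢w y≢w = agree _ _ (from-avoids-v ¬ux x≢w) (from-avoids-v ¬uy y≢w)
    sameVia-agree (yes _)  (no _)   _   _   = refl
    sameVia-agree (no _)   (yes _)  _   _   = refl

  nonUniversal-≤ : count (not ∘ isUniversal G) ≤ count (not ∘ isUniversal H)
  nonUniversal-≤ = count-mono-injection _ _
    (λ x ¬ux → proj₁ (to (x , not-isUniversal⁻ G ¬ux)))
    (λ x ¬ux → not-isUniversal⁺ H (proj₂ (to (x , not-isUniversal⁻ G ¬ux))))
    (λ x y _ _ tx≡ty → trans (≡-sym (from∘to _)) (trans (from-cong tx≡ty) (from∘to _)))

  nonUniversalLeaders-≤ : ∀ P → nonUniversalLeaders P ≤ nonUniversalLeaders (transport P)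
  nonUniversalLeaders-≤ P = nonUniversalLeaders-mono {P = P} {transport P} to (same-transport-to P)

module _ {m n} {G : Graph m} {H : Graph n} (I : G ≅′ H) where

  transport-inverse : ∀ P → transport (≅′-sym I) (transport I P) ≈P P
  transport-inverse = pullback-inverse (fromHom I) (fromHom (≅′-sym I)) (_≅_.from∘to (_≅′_.iso I))

  transport-reflects-≈ : ∀ {P Q} → transport I P ≈P transport I Q → P ≈P Q
  transport-reflects-≈ {P} {Q} IP≈IQ x y = begin
    same P x y                                      ≡⟨ ≡-sym (transport-inverse P x y) ⟩
    same (transport (≅′-sym I) (transport I P)) x y ≡⟨ transport-cong (≅′-sym I) IP≈IQ x y ⟩
    same (transport (≅′-sym I) (transport I Q)) x y ≡⟨ transport-inverse Q x y ⟩
    same Q x y                                      ∎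
    where open ≡-Reasoning

  nonUniversal-≡ : count (not ∘ isUniversal G) ≡ count (not ∘ isUniversal H)
  nonUniversal-≡ = ≤-antisym (nonUniversal-≤ I) (nonUniversal-≤ (≅′-sym I))

  nonUniversalLeaders-transport : ∀ P → nonUniversalLeaders (transport I P) ≡ nonUniversalLeaders P
  nonUniversalLeaders-transport P = ≤-antisym
    (begin
      nonUniversalLeaders (transport I P)
        ≤⟨ nonUniversalLeaders-≤ (≅′-sym I) (transport I P) ⟩
      nonUniversalLeaders (transport (≅′-sym I) (transport I P))
        ≡⟨ nonUniversalLeaders-cong {P = transport (≅′-sym I) (transport I P)} {P} (transport-inverse P) ⟩
      nonUniversalLeaders P ∎)
    (nonUniversalLeaders-≤ I P)
    where open ≤-Reasoning

  numParts-transport : ∀ P → numParts (transport I P) + m ≡ numParts P + n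
  numParts-transport P = begin
    numParts (transport I P) + m
      ≡⟨ cong₂ _+_ (numParts-split (transport I P)) (vertexCount-split {G = G}) ⟩
    (uH + nonUniversalLeaders (transport I P)) + (uG + count (not ∘ isUniversal G))
      ≡⟨ cong₂ (λ l c → (uH + l) + (uG + c)) (nonUniversalLeaders-transport P) nonUniversal-≡ ⟩
    (uH + nonUniversalLeaders P) + (uG + count (not ∘ isUniversal H))
      ≡⟨ exchange uH _ uG _ ⟩
    (uG + nonUniversalLeaders P) + (uH + count (not ∘ isUniversal H))
      ≡⟨ ≡-sym (cong₂ _+_ (numParts-split P) (vertexCount-split {G = H})) ⟩
    numParts P + n ∎
    where
    open ≡-Reasoning
    uG = count (isUniversal G)
    uH = count (isUniversal H)
    exchange : ∀ a l b c → (a + l) + (b + c) ≡ (b + l) + (a + c)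
    exchange = solve-∀

  numParts-transport-≥ : ∀ {k k′} → m + k′ ≡ n + k →
    ∀ {P} → k ≤ numParts P → k′ ≤ numParts (transport I P)
  numParts-transport-≥ {k} {k′} m+k′≡n+k {P} k≤∣P∣ =
    +-cancelˡ-≤ m k′ (numParts (transport I P)) (begin
    m + k′                       ≡⟨ m+k′≡n+k ⟩
    n + k                        ≤⟨ +-monoʳ-≤ n k≤∣P∣ ⟩
    n + numParts P               ≡⟨ +-comm n _ ⟩
    numParts P + n               ≡⟨ ≡-sym (numParts-transport P) ⟩
    numParts (transport I P) + m ≡⟨ +-comm _ m ⟩
    m + numParts (transport I P) ∎)
    where open ≤-Reasoning

module _ {n} {G : Graph n} where

  BellAdj : ISPartition G → ISPartition G → Set
  BellAdj P Q = ¬ P ≈P Q × ∃ λ v → agreeOff v P Q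

  BellAdj-resp-≈ : ∀ {P P′ Q Q′} → P ≈P P′ → Q ≈P Q′ → BellAdj P Q → BellAdj P′ Q′
  BellAdj-resp-≈ P≈P′ Q≈Q′ (P≉Q , v , agree) =
    (λ P′≈Q′ → P≉Q λ x y → trans (P≈P′ x y) (trans (P′≈Q′ x y) (≡-sym (Q≈Q′ x y)))) ,
    v , λ x y x≢v y≢v → trans (≡-sym (P≈P′ x y)) (trans (agree x y x≢v y≢v) (Q≈Q′ x y))

transport-BellAdj : ∀ {m n} {G : Graph m} {H : Graph n} (I : G ≅′ H) {P Q} →
  BellAdj P Q → BellAdj (transport I P) (transport I Q)
transport-BellAdj I (P≉Q , _ , agree) = P≉Q ∘ transport-reflects-≈ I , transport-agreeOff I P≉Q agree

transport-reflects-BellAdj : ∀ {m n} {G : Graph m} {H : Graph n} (I : G ≅′ H) {P Q} →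
  BellAdj (transport I P) (transport I Q) → BellAdj P Q
transport-reflects-BellAdj I {P} {Q} =
  BellAdj-resp-≈ {P = transport J (transport I P)} {P} {transport J (transport I Q)} {Q}
    (transport-inverse I P) (transport-inverse I Q) ∘ transport-BellAdj J
  where J = ≅′-sym I

lemma2p24 : (n₁ n₂ k₁ k₂ : ℕ) (G₁ : Graph n₁) (G₂ : Graph n₂) →
    n₁ + k₂ ≡ n₂ + k₁ →
    reduced G₁ ≅ reduced G₂ →
    Bell≥ k₁ G₁ ≅ Bell≥ k₂ G₂
lemma2p24 n₁ n₂ k₁ k₂ G₁ G₂ n₁+k₂≡n₂+k₁ I′ = record
  { to        = λ (P , k₁≤∣P∣) →
                  transport I P , numParts-transport-≥ I n₁+k₂≡n₂+k₁ k₁≤∣P∣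
  ; from      = λ (Q , k₂≤∣Q∣) →
                  transport J Q , numParts-transport-≥ J (≡-sym n₁+k₂≡n₂+k₁) k₂≤∣Q∣
  ; to-cong   = transport-cong I
  ; from-cong = transport-cong J
  ; from∘to   = λ (P , _) → transport-inverse I P
  -- ≅′-sym J has the same vertex maps as I, so transport (≅′-sym J) is transport I definitionally.
  ; to∘from   = λ (Q , _) → transport-inverse J Q
  ; E-pres    = λ _ _ → transport-BellAdj I
  ; E-refl    = λ (P , _) (Q , _) → transport-reflects-BellAdj I {P} {Q}
  }
  where
  I = reduced-iso I′
  J = ≅′-sym I
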